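{- Let $\Lambda$ be an $ADE$ Dynkin diagram and $Q_\Lambda=Q(\Lambda\times\Lambda)$. For every vertex $v$ of $\Lambda$ and every labeling $\rho:\mathrm{Vert}(Q_\Lambda)\to\mathbb{R}_{>0}$, if $\bar\mu_v(Q_\Lambda,\rho)=(Q',\rho')$ then $Q'=Q_\Lambda$.
   Context: A quiver is a finite directed graph without loops and directed 2-cycles. Mutation $\mu_v$: for each pair of arrows $u\to v$, $v\to w$ add an arrow $u\to w$; reverse all arrows incident to $v$; then repeatedly remove both arrows of any directed 2-cycle. A labeled quiver is a pair $(Q,\rho)$ with $\rho:\mathrm{Vert}(Q)\to\mathbb{R}_{>0}$; the labeled mutation is $\tilde\mu_v(Q,\rho)=(\mu_v(Q),\rho')$ with $\rho'(u)=\rho(u)$ for $u\ne v$ and $\rho'(v)\rho(v)=\prod_{u\to v}\rho(u)+\prod_{v\to w}\rho(w)$ (products over arrows of $Q$). Fix an $ADE$ Dynkin diagram $\Lambda$ (type $A_n,D_n,E_6,E_7,E_8$) with a bipartition $\epsilon:\mathrm{Vert}(\Lambda)\to\{0,1\}$. The quiver $Q_\Lambda$ has vertices $v_1,v_2$ for each vertex $v$ of $\Lambda$, with $\epsilon(v_1)=\epsilon(v_2)=\epsilon(v)$. For each edge $\{u,w\}$ of $\Lambda$ with $\epsilon(u)=0$, $\epsilon(w)=1$, $Q_\Lambda$ has the "red" arrows $u_1\to w_1$ and $u_2\to w_2$ and the "blue" arrows $w_2\to u_1$ and $w_1\to u_2$ (i.e. two red copies of $\Lambda$, with blue edges joining $u_1$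 to $w_2$ and $u_2$ to $w_1$ whenever $u,w$ are adjacent in $\Lambda$; red edges oriented from $\epsilon=0$ to $\epsilon=1$, blue edges from $\epsilon=1$ to $\epsilon=0$). For a vertex $v$ of $\Lambda$, the swap $s_v$ acts on labeled quivers $(Q,\rho)$ with vertex set $\mathrm{Vert}(Q_\Lambda)$: $s_v(Q,\rho)=(Q',\rho')$ where $\rho'$ agrees with $\rho$ except $\rho'(v_1)=\rho(v_2)$, $\rho'(v_2)=\rho(v_1)$, and $Q'$ is obtained from $Q$ by exchanging the roles of $v_1$ and $v_2$ (an arrow $u\to v_1$ of $Q$ becomes $u\to v_2$, etc.; arrows not incident to $v_1,v_2$ are unchanged). Since $v_1,v_2$ are not adjacent in $Q_\Lambda$, define $\bar\mu_v=s_v\circ\tilde\mu_{v_1}\circ\tilde\mu_{v_2}$. -}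

module Defs where

open import Data.Nat using (ℕ; zero; suc; _+_; _*_; _∸_; _≡ᵇ_; _<ᵇ_)
open import Data.Bool using (Bool; true; false; _∧_; _∨_; not; if_then_else_)
open import Data.Fin using (Fin; toℕ)
import Data.Fin as Fin
open import Data.Fin.Properties using () renaming (_≟_ to _≟F_)
open import Data.Bool.Properties using () renaming (_≟_ to _≟B_)
open import Data.Product using (_×_; _,_)
open import Data.List using (List; []; _∷_; foldr; map; concatMap; allFin)
open import Relation.Nullary.Decidable using (⌊_⌋)
open import Relation.Binary.PropositionalEquality using (_≡_; _≢_)

data ADE : ℕ → Set where
  A  : (m : ℕ) → ADE (suc m)
  D  : (m : ℕ) → ADE (4 + m)
  E6 : ADE 6
  E7 : ADE 7
  E8 : ADE 8

chainEdge : ℕ → ℕ → ℕ → Bool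
chainEdge len a b = (suc a ≡ᵇ b) ∧ (b <ᵇ len)

-- Chain 0 — … — (len-1) plus an extra vertex numbered len attached to vertex k.
branchEdge : ℕ → ℕ → ℕ → ℕ → Bool
branchEdge len k a b = chainEdge len a b ∨ ((a ≡ᵇ k) ∧ (b ≡ᵇ len))

edge : ∀ {n} → ADE n → ℕ → ℕ → Bool
edge (A m) a b = chainEdge (suc m) a b
edge (D m) a b = branchEdge (3 + m) (1 + m) a b   -- chain of n-1 vertices, extra at n-3
edge E6    a b = branchEdge 5 2 a b
edge E7    a b = branchEdge 6 2 a b
edge E8    a b = branchEdge 7 2 a b

adj : ∀ {n} → ADE n → Fin n → Fin n → Bool
adj Λ u w = edge Λ (toℕ u) (toℕ w) ∨ edge Λ (toℕ w) (toℕ u)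

-- ε : Vert(Λ) → {0,1}, encoded false = 0, true = 1; a bipartition.
IsBipartition : ∀ {n} → ADE n → (Fin n → Bool) → Set
IsBipartition Λ ε = ∀ u w → adj Λ u w ≡ true → ε u ≢ ε w

-- Quivers on the vertex set of Q_Λ: Vert n = Vert(Λ) × {copy 1, copy 2},
-- copy 1 = false, copy 2 = true.  A quiver is given by its arrow
-- multiplicities  Q x y = number of arrows x → y.

Vert : ℕ → Set
Vert n = Fin n × Bool

Quiver : ℕ → Set
Quiver n = Vert n → Vert n → ℕ

_==V_ : ∀ {n} → Vert n → Vert n → Bool
(u , i) ==V (w , j) = ⌊ u ≟F w ⌋ ∧ ⌊ i ≟B j ⌋

vertices : (n : ℕ) → List (Vert n)
vertices n = concatMap (λ u → (u , false) ∷ (u , true) ∷ []) (allFin n)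

-- The quiver Q_Λ (red arrows within a copy from ε=0 to ε=1,
-- blue arrows between copies from ε=1 to ε=0).
QΛ : ∀ {n} → ADE n → (Fin n → Bool) → Quiver n
QΛ Λ ε (u , i) (w , j) =
  if adj Λ u w ∧ not (ε u) ∧ ε w ∧ ⌊ i ≟B j ⌋ then 1
  else if adj Λ u w ∧ ε u ∧ not (ε w) ∧ not ⌊ i ≟B j ⌋ then 1
  else 0

-- For x,y ≠ v, after adding the composite arrows
-- there are Q x y + Q x v * Q v y arrows x → y and Q y x + Q y v * Q v x
-- arrows y → x; removing 2-cycles leaves the truncated difference.
mutate : ∀ {n} → Vert n → Quiver n → Quiver n
mutate v Q x y =
  if (x ==V v) ∨ (y ==V v) then Q y x
  else (Q x y + Q x v * Q v y) ∸ (Q y x + Q y v * Q v x)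

-- Labels.  The paper uses ℝ_{>0}; we allow an arbitrary carrier with
-- +, ·, 1 and division (ℝ_{>0} is an instance).

record LabelOps : Set₁ where
  field
    Carrier : Set
    _⊕_     : Carrier → Carrier → Carrier
    _⊗_     : Carrier → Carrier → Carrier
    one     : Carrier
    _⊘_     : Carrier → Carrier → Carrier

record LabeledQuiver (L : LabelOps) (n : ℕ) : Set where
  constructor ⟨_,_⟩
  field
    quiver : Quiver n
    label  : Vert n → LabelOps.Carrier L
open LabeledQuiver public

module _ (L : LabelOps) where
  open LabelOps L

  pow : Carrier → ℕ → Carrier
  pow r zero    = one
  pow r (suc k) = r ⊗ pow r k

  prodIn : ∀ {n} → Quiver n → (Vert n → Carrier) → Vert n → Carrier
  prodIn {n} Q ρ v = foldr _⊗_ one (map (λ u → pow (ρ u) (Q u v)) (vertices n))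

  prodOut : ∀ {n} → Quiver n → (Vert n → Carrier) → Vert n → Carrier
  prodOut {n} Q ρ v = foldr _⊗_ one (map (λ w → pow (ρ w) (Q v w)) (vertices n))

  lmutate : ∀ {n} → Vert n → LabeledQuiver L n → LabeledQuiver L n
  lmutate v ⟨ Q , ρ ⟩ =
    ⟨ mutate v Q
    , (λ x → if x ==V v then (prodIn Q ρ v ⊕ prodOut Q ρ v) ⊘ ρ v else ρ x) ⟩

  swapV : ∀ {n} → Fin n → Vert n → Vert n
  swapV v (u , i) = if ⌊ u ≟F v ⌋ then (u , not i) else (u , i)

  swap : ∀ {n} → Fin n → LabeledQuiver L n → LabeledQuiver L n
  swap v ⟨ Q , ρ ⟩ = ⟨ (λ x y → Q (swapV v x) (swapV v y)) , (λ x → ρ (swapV v x)) ⟩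

  μbar : ∀ {n} → Fin n → LabeledQuiver L n → LabeledQuiver L n
  μbar v P = swap v (lmutate (v , false) (lmutate (v , true) P))

module Submission where

-- Write a = v₂ and b = v₁; μ̄_v mutates at a, then at b, then swaps the
-- two copies of v.  Two facts about arbitrary quivers do the work:
--   * if a and b are not joined by arrows and Q has no 2-cycles, mutating
--     at a and then at b reverses every arrow incident to a or b, and
--     leaves the arrows x → y between the other vertices unchanged as
--     soon as the paths x → a → y, x → b → y are "balanced" against the
--     paths y → a → x, y → b → x (the composites added by the two
--     mutations then cancel against each other);
--   * the paths through a and b are balanced whenever a and b are
--     "mirror twins": the arrows out of a are the arrows into b and
--     vice versa.
-- In Q_Λ the two copies v₁, v₂ are unlinked mirror twins, because
-- exchanging the copy of one endpoint reverses an arrow.  Hence the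
-- double mutation reverses the arrows at v₁, v₂ and fixes all others,
-- and the final swap turns the reversed arrows back.

open import Defs
open import Data.Nat using (ℕ; _+_; _*_; _∸_; _≤_)
open import Data.Nat.Properties
  using (≤-total; m≤n⇒m∸n≡0; m∸n+n≡m; m*n≡0⇒m≡0∨n≡0; m≤m+n; m+n∸m≡n;
         +-identityʳ; +-cancelʳ-≡; +-comm; *-comm; *-zeroʳ)
open import Data.Nat.Tactic.RingSolver using (solve)
open import Data.Fin using (Fin)
open import Data.Fin.Properties using () renaming (_≟_ to _≟F_)
open import Data.Bool using (Bool; true; false; _∧_; not; if_then_else_)
open import Data.Bool.Properties using (∨-comm; ∨-zeroʳ; not-involutive) renaming (_≟_ to _≟B_)
open import Data.Product using (_,_)
open import Data.Product.Properties using (≡-dec)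
open import Data.List using (_∷_; [])
open import Data.Sum using (inj₁; inj₂)
open import Relation.Nullary using (Dec; yes; no; ¬_)
open import Relation.Nullary.Decidable using (⌊_⌋; isYes≗does; dec-true; dec-false)
open import Relation.Binary.Definitions using (DecidableEquality)
open import Relation.Binary.PropositionalEquality
  using (_≡_; _≢_; refl; sym; trans; cong; cong₂; subst; ≢-sym; module ≡-Reasoning)
open ≡-Reasoning

∸-from-difference : ∀ {x y q q'} → x + q' ≡ y + q → q * q' ≡ 0 → x ∸ y ≡ q
∸-from-difference {x} {y} {q} {q'} eq qq' with m*n≡0⇒m≡0∨n≡0 q qq'
... | inj₁ refl = m≤n⇒m∸n≡0 (subst (x ≤_) (trans eq (+-identityʳ y)) (m≤m+n x q'))
... | inj₂ refl = begin
  x ∸ y       ≡⟨ cong (_∸ y) (trans (sym (+-identityʳ x)) eq) ⟩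
  y + q ∸ y   ≡⟨ m+n∸m≡n y q ⟩
  q           ∎

∸-disjoint : ∀ q q' → q * q' ≡ 0 → q ∸ q' ≡ q
∸-disjoint q q' = ∸-from-difference (+-comm q q')

∸-excess : ∀ m n → m ∸ n + n ≡ n ∸ m + m
∸-excess m n with ≤-total m n
... | inj₁ m≤n rewrite m≤n⇒m∸n≡0 m≤n = sym (m∸n+n≡m m≤n)
... | inj₂ n≤m rewrite m≤n⇒m∸n≡0 n≤m = m∸n+n≡m n≤m

cancel-balanced : ∀ q q' p p' r r' → q * q' ≡ 0 → p + r ≡ p' + r' →
  ((q + p) ∸ (q' + p') + r) ∸ ((q' + p') ∸ (q + p) + r') ≡ q
cancel-balanced q q' p p' r r' qq' balance =
  ∸-from-difference
    (+-cancelʳ-≡ p' _ _ (shift ((q + p) ∸ (q' + p')) ((q' + p') ∸ (q + p)) (∸-excess (q + p) (q' + p'))))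
    qq'
  where
  -- d and e stand for the excesses (q + p) ∸ (q' + p') and (q' + p') ∸ (q + p).
  shift : ∀ d e → d + (q' + p') ≡ e + (q + p) → d + r + q' + p' ≡ e + r' + q + p'
  shift d e excess = begin
    d + r + q' + p'       ≡⟨ solve (d ∷ r ∷ q' ∷ p' ∷ []) ⟩
    d + (q' + p') + r     ≡⟨ cong (_+ r) excess ⟩
    e + (q + p) + r       ≡⟨ solve (e ∷ q ∷ p ∷ r ∷ []) ⟩
    e + q + (p + r)       ≡⟨ cong (e + q +_) balance ⟩
    e + q + (p' + r')     ≡⟨ solve (e ∷ q ∷ p' ∷ r' ∷ []) ⟩
    e + r' + q + p'       ∎

⌊⌋-true : ∀ {A : Set} (a? : Dec A) → A → ⌊ a? ⌋ ≡ true
⌊⌋-true a? a = trans (isYes≗does a?) (dec-true a? a)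

⌊⌋-false : ∀ {A : Set} (a? : Dec A) → ¬ A → ⌊ a? ⌋ ≡ false
⌊⌋-false a? ¬a = trans (isYes≗does a?) (dec-false a? ¬a)

==V-refl : ∀ {n} (x : Vert n) → (x ==V x) ≡ true
==V-refl (u , i) = cong₂ _∧_ (⌊⌋-true (u ≟F u) refl) (⌊⌋-true (i ≟B i) refl)

==V-distinct : ∀ {n} {x y : Vert n} → x ≢ y → (x ==V y) ≡ false
==V-distinct {x = u , i} {w , j} x≢y with u ≟F w
... | yes refl = ⌊⌋-false (i ≟B j) (λ i≡j → x≢y (cong (u ,_) i≡j))
... | no _     = refl

other-copy : ∀ {n} {u v : Fin n} {k l : Bool} → u ≢ v → (u , k) ≢ (v , l)
other-copy u≢v refl = u≢v refl

_≟V_ : ∀ {n} → DecidableEquality (Vert n)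
_≟V_ = ≡-dec _≟F_ _≟B_

NoTwoCycles : ∀ {n} → Quiver n → Set
NoTwoCycles Q = ∀ x y → Q x y * Q y x ≡ 0

mutate-at-source : ∀ {n} k (Q : Quiver n) y → mutate k Q k y ≡ Q y k
mutate-at-source k Q y rewrite ==V-refl k = refl

mutate-at-target : ∀ {n} k (Q : Quiver n) x → mutate k Q x k ≡ Q k x
mutate-at-target k Q x rewrite ==V-refl k | ∨-zeroʳ (x ==V k) = refl

mutate-away : ∀ {n} k (Q : Quiver n) {x y} → x ≢ k → y ≢ k →
  mutate k Q x y ≡ (Q x y + Q x k * Q k y) ∸ (Q y x + Q y k * Q k x)
mutate-away k Q x≢k y≢k rewrite ==V-distinct x≢k | ==V-distinct y≢k = refl

mutate-without-paths : ∀ {n} k (Q : Quiver n) {x y} → x ≢ k → y ≢ k →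
  Q x k * Q k y ≡ 0 → Q y k * Q k x ≡ 0 → Q x y * Q y x ≡ 0 →
  mutate k Q x y ≡ Q x y
mutate-without-paths k Q {x} {y} x≢k y≢k no-xky no-ykx no-cycle = begin
  mutate k Q x y                                        ≡⟨ mutate-away k Q x≢k y≢k ⟩
  (Q x y + Q x k * Q k y) ∸ (Q y x + Q y k * Q k x)     ≡⟨ cong₂ (λ s t → (Q x y + s) ∸ (Q y x + t)) no-xky no-ykx ⟩
  (Q x y + 0) ∸ (Q y x + 0)                             ≡⟨ cong₂ _∸_ (+-identityʳ (Q x y)) (+-identityʳ (Q y x)) ⟩
  Q x y ∸ Q y x                                         ≡⟨ ∸-disjoint (Q x y) (Q y x) no-cycle ⟩
  Q x y                                                 ∎

PathsBalanced : ∀ {n} → Quiver n → Vert n → Vert n → Set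
PathsBalanced Q a b = ∀ x y → Q x a * Q a y + Q x b * Q b y ≡ Q y a * Q a x + Q y b * Q b x

twins-balanced : ∀ {n} (Q : Quiver n) a b →
  (∀ y → Q a y ≡ Q y b) → (∀ y → Q b y ≡ Q y a) → PathsBalanced Q a b
twins-balanced Q a b a⇄b b⇄a x y = begin
  Q x a * Q a y + Q x b * Q b y   ≡⟨ cong₂ _+_ (cong₂ _*_ (sym (b⇄a x)) (a⇄b y)) (cong₂ _*_ (sym (a⇄b x)) (b⇄a y)) ⟩
  Q b x * Q y b + Q a x * Q y a   ≡⟨ +-comm (Q b x * Q y b) (Q a x * Q y a) ⟩
  Q a x * Q y a + Q b x * Q y b   ≡⟨ cong₂ _+_ (*-comm (Q a x) (Q y a)) (*-comm (Q b x) (Q y b)) ⟩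
  Q y a * Q a x + Q y b * Q b x   ∎

module DoubleMutation {n} (Q : Quiver n) (a b : Vert n) (a≢b : a ≢ b)
                      (acyclic : NoTwoCycles Q) (no-ab : Q a b ≡ 0) (no-ba : Q b a ≡ 0) where

  once : Quiver n
  once = mutate a Q

  twice : Quiver n
  twice = mutate b once

  -- No path through a starts or ends at b, so the first mutation
  -- leaves every arrow at b untouched.
  once-into-b : ∀ x → once x b ≡ Q x b
  once-into-b x with x ≟V a
  ... | yes refl = trans (mutate-at-source a Q b) (trans no-ba (sym no-ab))
  ... | no x≢a   = mutate-without-paths a Q x≢a (≢-sym a≢b)
                     (trans (cong (Q x a *_) no-ab) (*-zeroʳ (Q x a))) (cong (_* Q a x) no-ba) (acyclic x b)

  once-from-b : ∀ y → once b y ≡ Q b y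
  once-from-b y with y ≟V a
  ... | yes refl = trans (mutate-at-target a Q b) (trans no-ab (sym no-ba))
  ... | no y≢a   = mutate-without-paths a Q (≢-sym a≢b) y≢a
                     (cong (_* Q a y) no-ba) (trans (cong (Q y a *_) no-ab) (*-zeroʳ (Q y a))) (acyclic b y)

  twice-from-b : ∀ y → twice b y ≡ Q y b
  twice-from-b y = trans (mutate-at-source b once y) (once-into-b y)

  twice-into-b : ∀ x → twice x b ≡ Q b x
  twice-into-b x = trans (mutate-at-target b once x) (once-from-b x)

  -- Arrows at a are reversed by the first mutation and, a and b staying
  -- unlinked, not touched by the second.
  twice-from-a : ∀ y → twice a y ≡ Q y a
  twice-from-a y with y ≟V b
  ... | yes refl = twice-into-b a
  ... | no y≢b   = trans (mutate-without-paths b once a≢b y≢b no-path no-path-back no-cycle)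
                         (mutate-at-source a Q y)
    where
    no-path : once a b * once b y ≡ 0
    no-path = cong (_* once b y) (trans (mutate-at-source a Q b) no-ba)
    no-path-back : once y b * once b a ≡ 0
    no-path-back = trans (cong (once y b *_) (trans (mutate-at-target a Q b) no-ab)) (*-zeroʳ (once y b))
    no-cycle : once a y * once y a ≡ 0
    no-cycle = trans (cong₂ _*_ (mutate-at-source a Q y) (mutate-at-target a Q y)) (acyclic y a)

  twice-into-a : ∀ x → twice x a ≡ Q a x
  twice-into-a x with x ≟V b
  ... | yes refl = twice-from-b a
  ... | no x≢b   = trans (mutate-without-paths b once x≢b a≢b no-path no-path-back no-cycle)
                         (mutate-at-target a Q x)
    where
    no-path : once x b * once b a ≡ 0
    no-path = trans (cong (once x b *_) (trans (mutate-at-target a Q b) no-ab)) (*-zeroʳ (once x b))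
    no-path-back : once a b * once b x ≡ 0
    no-path-back = cong (_* once b x) (trans (mutate-at-source a Q b) no-ba)
    no-cycle : once x a * once a x ≡ 0
    no-cycle = trans (cong₂ _*_ (mutate-at-target a Q x) (mutate-at-source a Q x)) (acyclic a x)

  -- Away from a and b the composites added by the two mutations cancel.
  twice-away : PathsBalanced Q a b → ∀ {x y} → x ≢ a → x ≢ b → y ≢ a → y ≢ b → twice x y ≡ Q x y
  twice-away balanced {x} {y} x≢a x≢b y≢a y≢b = begin
    twice x y
      ≡⟨ mutate-away b once x≢b y≢b ⟩
    (once x y + once x b * once b y) ∸ (once y x + once y b * once b x)
      ≡⟨ cong₂ (λ s t → (once x y + s) ∸ (once y x + t))
               (cong₂ _*_ (once-into-b x) (once-from-b y)) (cong₂ _*_ (once-into-b y) (once-from-b x)) ⟩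
    (once x y + Q x b * Q b y) ∸ (once y x + Q y b * Q b x)
      ≡⟨ cong₂ (λ s t → (s + Q x b * Q b y) ∸ (t + Q y b * Q b x))
               (mutate-away a Q x≢a y≢a) (mutate-away a Q y≢a x≢a) ⟩
    ((Q x y + Q x a * Q a y) ∸ (Q y x + Q y a * Q a x) + Q x b * Q b y)
      ∸ ((Q y x + Q y a * Q a x) ∸ (Q x y + Q x a * Q a y) + Q y b * Q b x)
      ≡⟨ cancel-balanced _ _ _ _ _ _ (acyclic x y) (balanced x y) ⟩
    Q x y
      ∎

-- Number of arrows u_i → w_j in Q_Λ, given the adjacency of u and w in Λ,
-- the colours ε u, ε w and the copies i, j; by definition
-- QΛ Λ ε (u , i) (w , j) = arrowCount (adj Λ u w) (ε u) (ε w) i j.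
arrowCount : Bool → Bool → Bool → Bool → Bool → ℕ
arrowCount adjacent εu εw i j =
  if adjacent ∧ not εu ∧ εw ∧ ⌊ i ≟B j ⌋ then 1
  else if adjacent ∧ εu ∧ not εw ∧ not ⌊ i ≟B j ⌋ then 1
  else 0

-- Arrows u_i → w_j correspond to reversed arrows w_j → u_{i'} into the
-- other copy of u: red arrows turn into blue ones and vice versa.
arrowCount-flip : ∀ c εu εw i j → arrowCount c εu εw i j ≡ arrowCount c εw εu j (not i)
arrowCount-flip false _     _     _     _     = refl
arrowCount-flip true  false false _     _     = refl
arrowCount-flip true  true  true  _     _     = refl
arrowCount-flip true  false true  false false = refl
arrowCount-flip true  false true  false true  = refl
arrowCount-flip true  false true  true  false = refl
arrowCount-flip true  false true  true  true  = refl
arrowCount-flip true  true  false false false = refl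
arrowCount-flip true  true  false false true  = refl
arrowCount-flip true  true  false true  false = refl
arrowCount-flip true  true  false true  true  = refl

-- Red arrows go from colour 0 to colour 1, blue ones from 1 to 0,
-- so arrows never come in opposite pairs.
arrowCount-no-2-cycle : ∀ c εu εw i j → arrowCount c εu εw i j * arrowCount c εw εu j i ≡ 0
arrowCount-no-2-cycle false _     _     _     _     = refl
arrowCount-no-2-cycle true  false false _     _     = refl
arrowCount-no-2-cycle true  true  true  _     _     = refl
arrowCount-no-2-cycle true  false true  false false = refl
arrowCount-no-2-cycle true  false true  false true  = refl
arrowCount-no-2-cycle true  false true  true  false = refl
arrowCount-no-2-cycle true  false true  true  true  = refl
arrowCount-no-2-cycle true  true  false false false = refl
arrowCount-no-2-cycle true  true  false false true  = refl
arrowCount-no-2-cycle true  true  false true  false = refl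
arrowCount-no-2-cycle true  true  false true  true  = refl

arrowCount-same-colour : ∀ c ε i j → arrowCount c ε ε i j ≡ 0
arrowCount-same-colour false _     _ _ = refl
arrowCount-same-colour true  false _ _ = refl
arrowCount-same-colour true  true  _ _ = refl

module _ {n} (Λ : ADE n) (ε : Fin n → Bool) where

  adj-sym : ∀ u w → adj Λ u w ≡ adj Λ w u
  adj-sym u w = ∨-comm (edge Λ _ _) _

  QΛ-flip-source : ∀ u i y → QΛ Λ ε (u , i) y ≡ QΛ Λ ε y (u , not i)
  QΛ-flip-source u i (w , j) =
    trans (arrowCount-flip (adj Λ u w) (ε u) (ε w) i j)
          (cong (λ c → arrowCount c (ε w) (ε u) j (not i)) (adj-sym u w))

  QΛ-flip-target : ∀ x w j → QΛ Λ ε x (w , j) ≡ QΛ Λ ε (w , not j) x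
  QΛ-flip-target x w j = sym (trans (QΛ-flip-source w (not j) x)
                                    (cong (λ k → QΛ Λ ε x (w , k)) (not-involutive j)))

  QΛ-acyclic : NoTwoCycles (QΛ Λ ε)
  QΛ-acyclic (u , i) (w , j) =
    trans (cong (λ c → arrowCount (adj Λ u w) (ε u) (ε w) i j * arrowCount c (ε w) (ε u) j i) (adj-sym w u))
          (arrowCount-no-2-cycle (adj Λ u w) (ε u) (ε w) i j)

  QΛ-copies-unlinked : ∀ v i j → QΛ Λ ε (v , i) (v , j) ≡ 0
  QΛ-copies-unlinked v = arrowCount-same-colour (adj Λ v v) (ε v)

  module CopiesOf (v : Fin n) = DoubleMutation (QΛ Λ ε) (v , true) (v , false) (λ ())
    QΛ-acyclic (QΛ-copies-unlinked v true false) (QΛ-copies-unlinked v false true)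

  copies-balanced : ∀ v → PathsBalanced (QΛ Λ ε) (v , true) (v , false)
  copies-balanced v = twins-balanced (QΛ Λ ε) (v , true) (v , false)
    (QΛ-flip-source v true) (QΛ-flip-source v false)

  twice-from-copy : ∀ v k y → CopiesOf.twice v (v , k) y ≡ QΛ Λ ε y (v , k)
  twice-from-copy v true  = CopiesOf.twice-from-a v
  twice-from-copy v false = CopiesOf.twice-from-b v

  twice-into-copy : ∀ v k x → CopiesOf.twice v x (v , k) ≡ QΛ Λ ε (v , k) x
  twice-into-copy v true  = CopiesOf.twice-into-a v
  twice-into-copy v false = CopiesOf.twice-into-b v

-- Deciding whether u and w are v also evaluates the swap s_v, so each case
-- starts from the double mutation at the swapped endpoints.
proposition3p1 : ∀ {n} (Λ : ADE n) (ε : Fin n → Bool) → IsBipartition Λ ε →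
    (L : LabelOps) (v : Fin n) (ρ : Vert n → LabelOps.Carrier L) →
    ∀ x y → quiver (μbar L v ⟨ QΛ Λ ε , ρ ⟩) x y ≡ QΛ Λ ε x y
proposition3p1 Λ ε _ L v ρ (u , i) (w , j) with u ≟F v | w ≟F v
... | no u≢v | no w≢v = begin
  twice (u , i) (w , j)                           ≡⟨ twice-away (copies-balanced Λ ε v)
                                                       (other-copy u≢v) (other-copy u≢v)
                                                       (other-copy w≢v) (other-copy w≢v) ⟩
  QΛ Λ ε (u , i) (w , j)                          ∎
  where open CopiesOf Λ ε v
... | yes refl | no w≢v = begin
  twice (v , not i) (w , j)                       ≡⟨ twice-from-copy Λ ε v (not i) (w , j) ⟩
  QΛ Λ ε (w , j) (v , not i)                      ≡⟨ QΛ-flip-source Λ ε v i (w , j) ⟨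
  QΛ Λ ε (v , i) (w , j)                          ∎
  where open CopiesOf Λ ε v
... | no u≢v | yes refl = begin
  twice (u , i) (v , not j)                       ≡⟨ twice-into-copy Λ ε v (not j) (u , i) ⟩
  QΛ Λ ε (v , not j) (u , i)                      ≡⟨ QΛ-flip-target Λ ε (u , i) v j ⟨
  QΛ Λ ε (u , i) (v , j)                          ∎
  where open CopiesOf Λ ε v
... | yes refl | yes refl = begin
  twice (v , not i) (v , not j)                   ≡⟨ twice-from-copy Λ ε v (not i) (v , not j) ⟩
  QΛ Λ ε (v , not j) (v , not i)                  ≡⟨ QΛ-copies-unlinked Λ ε v (not j) (not i) ⟩
  0                                               ≡⟨ QΛ-copies-unlinked Λ ε v i j ⟨
  QΛ Λ ε (v , i) (v , j)                          ∎
  where open CopiesOf Λ ε v
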